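{- Let $n\ge1$. For any $\mathcal{C},\mathcal{C}'\in\{\bullet,\circ\}^n$, the set $$\mathcal{F}(\mathcal{C}'\to\mathcal{C}) := (R\circ f)^{ -1}\{\mathcal{C}'\}\cap(R\circ f\circ\pi)^{ -1}\{\mathcal{C}\}\subseteq\widehat{\mathcal{T}}_n$$ is non-empty if and only if $W(\mathcal{C}'\to\mathcal{C})\neq 0$, and in this case its cardinality equals $|R^{ -1}\{\mathcal{C}'\}|$. Thus, when $\alpha=\beta=1$, $$|\mathcal{F}(\mathcal{C}'\to\mathcal{C})|=|R^{ -1}\{\mathcal{C}'\}|\,W(\mathcal{C}'\to\mathcal{C}).$$
   Context: Fix $\alpha,\beta\in(0,1]$. Configurations are strings in $\{\bullet,\circ\}^n$. Transition rates: $W(\mathcal{C}\to\mathcal{C}')=\alpha$ if $\mathcal{C}=\circ\mathcal{A}$, $\mathcal{C}'=\bullet\mathcal{A}$; $=\beta$ if $\mathcal{C}=\mathcal{A}\bullet$, $\mathcal{C}'=\mathcal{A}\circ$; $=1$ if $\mathcal{C}=\mathcal{A}\bullet\circ\mathcal{A}'$, $\mathcal{C}'=\mathcal{A}\circ\bullet\mathcal{A}'$; $=0$ otherwise ($\mathcal{A},\mathcal{A}'$ arbitrary, possibly empty strings). A plane binary tree is a rooted tree in which every vertex is either an endpoint (leaf) or has exactly two children, an ordered left child and right child. $\mathcal{T}_n$ is the set of plane binary trees with $n+2$ endpoints, ordered left to right. A non-root vertex is a left (resp. right) descendent if it is the left (resp. right) child of its parent. $R:\mathcal{T}_n\to\{\bullet,\circ\}^n$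 sends $T$ to $(t_1,\dots,t_n)$ with $t_k=\bullet$ if the $(k+1)$-th endpoint from the left is a left descendent, $t_k=\circ$ if it is a right descendent. A last branching vertex is a non-endpoint vertex both of whose children are endpoints. A marked tree is a pair $(T,v)$ with $T\in\mathcal{T}_n$ and $v$ a last branching vertex of $T$; $\widehat{\mathcal{T}}_n$ is the set of marked trees and $f(T,v)=T$. The map $\pi:\widehat{\mathcal{T}}_n\to\widehat{\mathcal{T}}_n$: given $(T,v)$, contract $v$ (delete its two endpoint children, so $v$ becomes an endpoint $v'$); then choose an endpoint $w$ of the contracted tree, replace $w$ by a vertex with two endpoint children, and mark this new vertex. If $v$ is a right descendent: if $v'$ is not the rightmost endpoint, $w$ is the first endpoint to the right of $v'$ that is a right descendent; otherwise $w$ is the rightmost endpoint that is a left descendent. If $v$ is a left descendent: if $v'$ is not the leftmost endpoint, $w$ is the first endpoint to the left of $v'$ that is a left descendent; otherwise $w$ is the leftmost endpoint that is a right descendent.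
   Formalization: The parameters α and β range over the rationals in (0,1]. -}

module Defs where

open import Data.Bool using (Bool; true; false; if_then_else_; _∧_; not)
open import Data.Bool.Properties renaming (_≟_ to _≟B_)
open import Data.Nat using (ℕ; zero; suc; _+_; _∸_; _<ᵇ_; _≡ᵇ_)
open import Data.List using (List; []; _∷_; _++_; length; take; drop; filterᵇ; upTo; head; last)
open import Data.List.Properties using (≡-dec)
open import Data.Maybe using (Maybe; just; nothing; fromMaybe)
open import Data.Product using (Σ; _×_; proj₁)
open import Data.Vec using (Vec; toList)
open import Data.Rational using (ℚ; 0ℚ; 1ℚ)
open import Relation.Nullary.Decidable using (⌊_⌋)
open import Relation.Binary.PropositionalEquality using (_≡_)

-- Configurations: Vec Bool n, with  true = •  and  false = ∘.
Config : ℕ → Set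
Config n = Vec Bool n

eqL : List Bool → List Bool → Bool
eqL a b = ⌊ ≡-dec _≟B_ a b ⌋

isInj : List Bool → List Bool → Bool
isInj (false ∷ a) (true ∷ b) = eqL a b
isInj _ _ = false

isEjRev : List Bool → List Bool → Bool
isEjRev (true ∷ a) (false ∷ b) = eqL a b
isEjRev _ _ = false

isEj : List Bool → List Bool → Bool
isEj a b = isEjRev (Data.List.reverse a) (Data.List.reverse b)

isHop : List Bool → List Bool → Bool
isHop (true ∷ false ∷ a) (false ∷ true ∷ b) = eqL a b
isHop (x ∷ a) (y ∷ b) = ⌊ x ≟B y ⌋ ∧ isHop a b
isHop _ _ = false

-- Transition rate W(X → Y) (the three cases are mutually exclusive).
W : ℚ → ℚ → {n : ℕ} → Config n → Config n → ℚ
W α β X Y =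
  if isInj (toList X) (toList Y) then α else
  if isEj (toList X) (toList Y) then β else
  if isHop (toList X) (toList Y) then 1ℚ else 0ℚ

data Tree : Set where
  leaf : Tree
  node : Tree → Tree → Tree

leaves : Tree → ℕ
leaves leaf = 1
leaves (node l r) = leaves l + leaves r

𝒯 : ℕ → Set
𝒯 n = Σ Tree (λ T → leaves T ≡ n + 2)

-- side of each endpoint, left to right: true = left descendent, false = right
sidesAt : Bool → Tree → List Bool
sidesAt b leaf = b ∷ []
sidesAt b (node l r) = sidesAt true l ++ sidesAt false r

-- (the root is not a descendent; a one-vertex tree has no descendent endpoints)
sides : Tree → List Bool
sides leaf = []
sides (node l r) = sidesAt true l ++ sidesAt false r

-- R : drop the first and last endpoint, record the side (true = •, false = ∘)
R : Tree → List Bool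
R T = take (length (sides T) ∸ 2) (drop 1 (sides T))

-- Marked trees: a tree together with a last branching vertex v, encoded
-- as the path from the root to v (a zipper) ending at the cherry v.
data MTree : Set where
  cherry : MTree                   -- v itself, with its two endpoint children
  inL    : MTree → Tree → MTree
  inR    : Tree → MTree → MTree

f : MTree → Tree
f cherry = node leaf leaf
f (inL m t) = node (f m) t
f (inR t m) = node t (f m)

𝒯̂ : ℕ → Set
𝒯̂ n = Σ MTree (λ m → leaves (f m) ≡ n + 2)

-- contraction of v: v becomes an endpoint v'
contract : MTree → Tree
contract cherry = leaf
contract (inL m t) = node (contract m) t
contract (inR t m) = node t (contract m)

-- index (from 0, left to right) of the endpoint v' in the contracted tree
idx : MTree → ℕ
idx cherry = 0
idx (inL m t) = idx m
idx (inR t m) = leaves t + idx m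

-- side of v: just true = left descendent, just false = right, nothing = root
sideOf : MTree → Maybe Bool
sideOf cherry = nothing
sideOf (inL cherry t) = just true
sideOf (inR t cherry) = just false
sideOf (inL m t) = sideOf m
sideOf (inR t m) = sideOf m

expand : Tree → ℕ → MTree
expand leaf j = cherry
expand (node l r) j =
  if j <ᵇ leaves l then inL (expand l j) r else inR l (expand r (j ∸ leaves l))

at : List Bool → ℕ → Maybe Bool
at [] _ = nothing
at (x ∷ xs) zero = just x
at (x ∷ xs) (suc j) = at xs j

isSide : Bool → Maybe Bool → Bool
isSide b (just c) = ⌊ b ≟B c ⌋
isSide b nothing = false

chooseW : MTree → ℕ
chooseW m = fromMaybe 0 (pick (sideOf m))
  where
  s = sides (contract m)
  k = length s
  i = idx m
  isL : ℕ → Bool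
  isL j = isSide true (at s j)
  isRt : ℕ → Bool
  isRt j = isSide false (at s j)
  pick : Maybe Bool → Maybe ℕ
  pick (just false) =
    if suc i <ᵇ k
    then head (filterᵇ (λ j → (i <ᵇ j) ∧ isRt j) (upTo k))
    else last (filterᵇ isL (upTo k))
  pick (just true) =
    if 0 <ᵇ i
    then last (filterᵇ (λ j → (j <ᵇ i) ∧ isL j) (upTo k))
    else head (filterᵇ isRt (upTo k))
  pick nothing = nothing   -- v is the root (only when n = 0)

π : MTree → MTree
π m = expand (contract m) (chooseW m)

𝓕 : (n : ℕ) → Config n → Config n → Set
𝓕 n C' C = Σ (𝒯̂ n) (λ x → (R (f (proj₁ x)) ≡ toList C') × (R (f (π (proj₁ x))) ≡ toList C))

Rinv : (n : ℕ) → Config n → Set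
Rinv n C' = Σ (𝒯 n) (λ T → R (proj₁ T) ≡ toList C')

module Submission where

-- Read the endpoints of a tree from left to right, writing • for a left and ∘ for a right descendent;
-- the resulting side word is •X∘ with X = R(T). The two children of a last branching vertex v form an
-- occurrence of •∘ in it, every occurrence of •∘ arises from exactly one v, and contracting v replaces
-- the pair by the side of v. If the side word of (T, v) is P•∘Q, the endpoint w chosen by π is exactly
-- the one whose expansion produces P a b Q, where a = • iff P is empty and b = • iff Q is nonempty:
-- an injection at the left end, an ejection at the right end and a hop •∘ → ∘• in between. Hence
-- R(f(π(T, v))) is determined by R(T) and the position of v, every allowed transition C' → C comes
-- from exactly one position, and (T, v) ↦ T is a bijection 𝓕(C' → C) ≅ R⁻¹{C'} when W(C' → C) ≠ 0,
-- while 𝓕(C' → C) is empty otherwise.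

open import Defs
open import Data.Nat using (ℕ; _≤_)
open import Data.Fin using (Fin)
open import Data.Product using (_×_)
open import Data.Rational using (ℚ; 0ℚ; 1ℚ; _<_; _*_; _/_) renaming (_≤_ to _≤ℚ_)
open import Data.Integer using (+_)
open import Function.Bundles using (_⇔_; _↔_)
open import Relation.Binary.PropositionalEquality using (_≡_; _≢_)

open import Axiom.UniquenessOfIdentityProofs using (module Decidable⇒UIP)
open import Data.Bool using (Bool; true; false; if_then_else_; not; _∧_; _∨_)
open import Data.Bool.Properties using (T-≡; ∨-zeroʳ) renaming (_≟_ to _≟B_)
open import Data.Empty using (⊥; ⊥-elim)
import Data.Fin as Fin
open import Data.Fin.Permutation using (↔⇒≡)
open import Data.List using (List; []; _∷_; _++_; _∷ʳ_; length; null; reverse; take; filterᵇ; upTo; head; last; initLast; _∷ʳ′_)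
import Data.List.Properties as List
open import Data.List.Relation.Unary.All using (All; []; _∷_)
open import Data.Maybe using (Maybe; just; fromMaybe)
open import Data.Nat as ℕ using (zero; suc; _+_; _∸_; _<ᵇ_; z≤n; s≤s)
import Data.Nat.Properties as ℕ
open import Data.Product using (_,_; proj₁; proj₂; ∃; ∃₂; map)
import Data.Rational.Properties as ℚ
open import Data.Sum using (_⊎_; inj₁; inj₂)
open import Data.Vec using (toList)
open import Data.Vec.Properties using (length-toList)
open import Function using (_∘_; case_of_)
open import Function.Bundles using (Equivalence; Inverse; mk⇔; mk↔ₛ′)
open import Function.Properties.Inverse using (↔-sym; ↔-trans)
open import Relation.Binary.Definitions using (tri<; tri≈; tri>)
open import Relation.Binary.PropositionalEquality using (refl; sym; trans; cong; cong₂; subst; subst₂; module ≡-Reasoning)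
open import Relation.Nullary using (¬_)
open import Relation.Nullary.Decidable using (T?; toWitness; fromWitness)

<⇒<ᵇ≡true : ∀ {m n} → m ℕ.< n → (m <ᵇ n) ≡ true
<⇒<ᵇ≡true = Equivalence.to T-≡ ∘ ℕ.<⇒<ᵇ

<ᵇ≡true⇒< : ∀ {m n} → (m <ᵇ n) ≡ true → m ℕ.< n
<ᵇ≡true⇒< {m} {n} = ℕ.<ᵇ⇒< m n ∘ Equivalence.from T-≡

≤⇒<ᵇ≡false : ∀ {m n} → n ≤ m → (m <ᵇ n) ≡ false
≤⇒<ᵇ≡false {m} {n} n≤m with m <ᵇ n in eq
... | false = refl
... | true  = ⊥-elim (ℕ.<⇒≱ (<ᵇ≡true⇒< eq) n≤m)

<ᵇ≡false⇒≥ : ∀ {m n} → (m <ᵇ n) ≡ false → n ≤ m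
<ᵇ≡false⇒≥ {m} {n} m≮n = ℕ.≮⇒≥ (λ m<n → case trans (sym m≮n) (<⇒<ᵇ≡true m<n) of λ ())

<⇒≡+suc : ∀ {i j} → i ℕ.< j → ∃ λ d → j ≡ i + suc d
<⇒≡+suc {i} i<j with ℕ.m≤n⇒∃[o]m+o≡n i<j
... | d , refl = d , sym (ℕ.+-suc i d)

last-∷ʳ : ∀ {A : Set} (xs : List A) y → last (xs ∷ʳ y) ≡ just y
last-∷ʳ []           y = refl
last-∷ʳ (_ ∷ [])     y = refl
last-∷ʳ (_ ∷ x ∷ xs) y = last-∷ʳ (x ∷ xs) y

last-++-∷ : ∀ {A : Set} (xs : List A) y ys → last (xs ++ y ∷ ys) ≡ last (y ∷ ys)
last-++-∷ []           y ys = refl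
last-++-∷ (_ ∷ [])     y ys = refl
last-++-∷ (_ ∷ x ∷ xs) y ys = last-++-∷ (x ∷ xs) y ys

length-∷ʳ : ∀ {A : Set} (xs : List A) y → length (xs ∷ʳ y) ≡ suc (length xs)
length-∷ʳ xs y = trans (List.length-++ xs) (ℕ.+-comm (length xs) 1)

take-length-++ : ∀ {A : Set} (xs ys : List A) → take (length xs) (xs ++ ys) ≡ xs
take-length-++ []       ys = refl
take-length-++ (x ∷ xs) ys = cong (x ∷_) (take-length-++ xs ys)

null-∷ʳ : ∀ {A : Set} (xs : List A) x → null (xs ∷ʳ x) ≡ false
null-∷ʳ []      x = refl
null-∷ʳ (_ ∷ _) x = refl

++-injective : ∀ {A : Set} (xs xs' : List A) {ys ys'} →
               length xs ≡ length xs' → xs ++ ys ≡ xs' ++ ys' → xs ≡ xs' × ys ≡ ys'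
++-injective []       []        _ e = refl , e
++-injective (x ∷ xs) (x' ∷ xs') l e with List.∷-injective e
... | refl , e' with ++-injective xs xs' (ℕ.suc-injective l) e'
...   | refl , refl = refl , refl

≡-irrelevantᴸ : ∀ {a b : List Bool} (p q : a ≡ b) → p ≡ q
≡-irrelevantᴸ = Decidable⇒UIP.≡-irrelevant (List.≡-dec _≟B_)

↔Fin-empty : ∀ {A : Set} {m} → ¬ A → A ↔ Fin m → m ≡ 0
↔Fin-empty {m = zero}  _  _   = refl
↔Fin-empty {m = suc _} ¬A A↔m = ⊥-elim (¬A (Inverse.from A↔m Fin.zero))

-- Positions in a word

at-++ˡ : ∀ xs ys {j} → j ℕ.< length xs → at (xs ++ ys) j ≡ at xs j
at-++ˡ (x ∷ xs) ys {zero}  _         = refl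
at-++ˡ (x ∷ xs) ys {suc j} (s≤s j<) = at-++ˡ xs ys j<

at-++ʳ : ∀ xs ys j → at (xs ++ ys) (length xs + j) ≡ at ys j
at-++ʳ []       ys j = refl
at-++ʳ (x ∷ xs) ys j = at-++ʳ xs ys j

at-++-∷ : ∀ xs x ys → at (xs ++ x ∷ ys) (length xs) ≡ just x
at-++-∷ []       x ys = refl
at-++-∷ (_ ∷ xs) x ys = at-++-∷ xs x ys

at-++-∷-∷ : ∀ xs x y ys → at (xs ++ x ∷ y ∷ ys) (suc (length xs)) ≡ just y
at-++-∷-∷ []       x y ys = refl
at-++-∷-∷ (_ ∷ xs) x y ys = at-++-∷-∷ xs x y ys

at⇒< : ∀ xs j {y} → at xs j ≡ just y → j ℕ.< length xs
at⇒< (x ∷ xs) zero    _ = s≤s z≤n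
at⇒< (x ∷ xs) (suc j) e = s≤s (at⇒< xs j e)

at-allFalse : ∀ {xs} → All (_≡ false) xs → ∀ {j} → j ℕ.< length xs → at xs j ≡ just false
at-allFalse (refl ∷ _)  {zero}  _        = refl
at-allFalse (_ ∷ all)   {suc j} (s≤s j<) = at-allFalse all j<

allFalse-∷ʳ : ∀ {xs} → All (_≡ false) xs → false ∷ xs ≡ xs ∷ʳ false
allFalse-∷ʳ []           = refl
allFalse-∷ʳ (refl ∷ all) = cong (false ∷_) (allFalse-∷ʳ all)

expandWord : List Bool → ℕ → List Bool
expandWord []       j       = []
expandWord (x ∷ xs) zero    = true ∷ false ∷ xs
expandWord (x ∷ xs) (suc j) = x ∷ expandWord xs j

expandWord-++ˡ : ∀ xs ys {j} → j ℕ.< length xs → expandWord (xs ++ ys) j ≡ expandWord xs j ++ ys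
expandWord-++ˡ (x ∷ xs) ys {zero}  _        = refl
expandWord-++ˡ (x ∷ xs) ys {suc j} (s≤s j<) = cong (x ∷_) (expandWord-++ˡ xs ys j<)

expandWord-++ʳ : ∀ xs ys j → expandWord (xs ++ ys) (length xs + j) ≡ xs ++ expandWord ys j
expandWord-++ʳ []       ys j = refl
expandWord-++ʳ (x ∷ xs) ys j = cong (x ∷_) (expandWord-++ʳ xs ys j)

data FirstFalseAt : List Bool → ℕ → Set where
  here  : ∀ {xs} → FirstFalseAt (false ∷ xs) 0
  there : ∀ {xs i} → FirstFalseAt xs i → FirstFalseAt (true ∷ xs) (suc i)

data LastTrueAt : List Bool → ℕ → Set where
  here  : ∀ {xs} → All (_≡ false) xs → LastTrueAt (true ∷ xs) 0
  there : ∀ {x xs i} → LastTrueAt xs i → LastTrueAt (x ∷ xs) (suc i)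

at-firstFalse : ∀ {xs i} → FirstFalseAt xs i → at xs i ≡ just false
at-firstFalse here      = refl
at-firstFalse (there p) = at-firstFalse p

at-before-firstFalse : ∀ {xs i} → FirstFalseAt xs i → ∀ {j} → j ℕ.< i → at xs j ≡ just true
at-before-firstFalse (there p) {zero}  _        = refl
at-before-firstFalse (there p) {suc j} (s≤s j<) = at-before-firstFalse p j<

firstFalse< : ∀ {xs i} → FirstFalseAt xs i → i ℕ.< length xs
firstFalse< {xs} {i} p = at⇒< xs i (at-firstFalse p)

expandWord-firstFalse : ∀ {xs i} → FirstFalseAt xs i → expandWord xs i ≡ true ∷ xs
expandWord-firstFalse here      = refl
expandWord-firstFalse (there p) = cong (true ∷_) (expandWord-firstFalse p)

firstFalse-last : ∀ xs → last xs ≡ just false → ∃ (FirstFalseAt xs)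
firstFalse-last (false ∷ xs)    _ = 0 , here
firstFalse-last (true ∷ x ∷ xs) e = map suc there (firstFalse-last (x ∷ xs) e)

at-lastTrue : ∀ {xs i} → LastTrueAt xs i → at xs i ≡ just true
at-lastTrue (here _)  = refl
at-lastTrue (there p) = at-lastTrue p

at-after-lastTrue : ∀ {xs i} → LastTrueAt xs i → ∀ {j} → i ℕ.< j → j ℕ.< length xs → at xs j ≡ just false
at-after-lastTrue (here all) {suc j} _        (s≤s j<) = at-allFalse all j<
at-after-lastTrue (there p)  {suc j} (s≤s i<) (s≤s j<) = at-after-lastTrue p i< j<

lastTrue< : ∀ {xs i} → LastTrueAt xs i → i ℕ.< length xs
lastTrue< {xs} {i} p = at⇒< xs i (at-lastTrue p)

expandWord-lastTrue : ∀ {xs i} → LastTrueAt xs i → expandWord xs i ≡ xs ∷ʳ false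
expandWord-lastTrue (here all)          = cong (true ∷_) (allFalse-∷ʳ all)
expandWord-lastTrue {x ∷ _} (there p) = cong (x ∷_) (expandWord-lastTrue p)

lastTrue-or-allFalse : ∀ xs → ∃ (LastTrueAt xs) ⊎ All (_≡ false) xs
lastTrue-or-allFalse []       = inj₂ []
lastTrue-or-allFalse (x ∷ xs) with lastTrue-or-allFalse xs
... | inj₁ (i , p) = inj₁ (suc i , there p)
lastTrue-or-allFalse (true ∷ xs)  | inj₂ all = inj₁ (0 , here all)
lastTrue-or-allFalse (false ∷ xs) | inj₂ all = inj₂ (refl ∷ all)

lastTrue-∷ : ∀ xs → ∃ (LastTrueAt (true ∷ xs))
lastTrue-∷ xs with lastTrue-or-allFalse xs
... | inj₁ (i , p) = suc i , there p
... | inj₂ all     = 0 , here all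

-- Searching the positions 0, …, k-1 with filterᵇ

filterᵇ-upTo-suc : ∀ (p : ℕ → Bool) k → filterᵇ p (upTo (suc k)) ≡ filterᵇ p (upTo k) ++ filterᵇ p (k ∷ [])
filterᵇ-upTo-suc p k = trans (cong (filterᵇ p) (sym (List.upTo-∷ʳ k))) (List.filter-++ (T? ∘ p) (upTo k) (k ∷ []))

filterᵇ-[]-accept : ∀ (p : ℕ → Bool) x → p x ≡ true → filterᵇ p (x ∷ []) ≡ x ∷ []
filterᵇ-[]-accept p x px with p x
filterᵇ-[]-accept p x refl | .true = refl

filterᵇ-[]-reject : ∀ (p : ℕ → Bool) x → p x ≡ false → filterᵇ p (x ∷ []) ≡ []
filterᵇ-[]-reject p x px with p x
filterᵇ-[]-reject p x refl | .false = refl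

filterᵇ-upTo-none : ∀ (p : ℕ → Bool) k → (∀ {j} → j ℕ.< k → p j ≡ false) → filterᵇ p (upTo k) ≡ []
filterᵇ-upTo-none p zero    _    = refl
filterᵇ-upTo-none p (suc k) none = begin
  filterᵇ p (upTo (suc k))                 ≡⟨ filterᵇ-upTo-suc p k ⟩
  filterᵇ p (upTo k) ++ filterᵇ p (k ∷ []) ≡⟨ cong₂ _++_ (filterᵇ-upTo-none p k (none ∘ ℕ.m<n⇒m<1+n))
                                                        (filterᵇ-[]-reject p k (none ℕ.≤-refl)) ⟩
  []                                       ∎
  where open ≡-Reasoning

head-filterᵇ-upTo : ∀ (p : ℕ → Bool) {k w} → w ℕ.< k → p w ≡ true → (∀ {j} → j ℕ.< w → p j ≡ false) →
                    head (filterᵇ p (upTo k)) ≡ just w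
head-filterᵇ-upTo p {suc k} {w} w<1+k pw before with ℕ.m<1+n⇒m<n∨m≡n w<1+k
... | inj₁ w<k = begin
  head (filterᵇ p (upTo (suc k)))                 ≡⟨ cong head (filterᵇ-upTo-suc p k) ⟩
  head (filterᵇ p (upTo k) ++ filterᵇ p (k ∷ [])) ≡⟨ head-++ (head-filterᵇ-upTo p w<k pw before) ⟩
  just w                                          ∎
  where
  open ≡-Reasoning
  head-++ : ∀ {xs ys : List ℕ} → head xs ≡ just w → head (xs ++ ys) ≡ just w
  head-++ {_ ∷ _} e = e
... | inj₂ refl = begin
  head (filterᵇ p (upTo (suc k)))                 ≡⟨ cong head (filterᵇ-upTo-suc p k) ⟩
  head (filterᵇ p (upTo k) ++ filterᵇ p (k ∷ [])) ≡⟨ cong₂ (λ xs ys → head (xs ++ ys))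
                                                           (filterᵇ-upTo-none p k before) (filterᵇ-[]-accept p k pw) ⟩
  just k                                          ∎
  where open ≡-Reasoning

last-filterᵇ-upTo : ∀ (p : ℕ → Bool) {k w} → w ℕ.< k → p w ≡ true → (∀ {j} → w ℕ.< j → j ℕ.< k → p j ≡ false) →
                    last (filterᵇ p (upTo k)) ≡ just w
last-filterᵇ-upTo p {suc k} {w} w<1+k pw after with ℕ.m<1+n⇒m<n∨m≡n w<1+k
... | inj₁ w<k = begin
  last (filterᵇ p (upTo (suc k)))                 ≡⟨ cong last (filterᵇ-upTo-suc p k) ⟩
  last (filterᵇ p (upTo k) ++ filterᵇ p (k ∷ [])) ≡⟨ cong (λ ys → last (filterᵇ p (upTo k) ++ ys))
                                                           (filterᵇ-[]-reject p k (after w<k ℕ.≤-refl)) ⟩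
  last (filterᵇ p (upTo k) ++ [])                 ≡⟨ cong last (List.++-identityʳ (filterᵇ p (upTo k))) ⟩
  last (filterᵇ p (upTo k))                       ≡⟨ last-filterᵇ-upTo p w<k pw (λ w<j j<k → after w<j (ℕ.m<n⇒m<1+n j<k)) ⟩
  just w                                          ∎
  where open ≡-Reasoning
... | inj₂ refl = begin
  last (filterᵇ p (upTo (suc k)))                 ≡⟨ cong last (filterᵇ-upTo-suc p k) ⟩
  last (filterᵇ p (upTo k) ++ filterᵇ p (k ∷ [])) ≡⟨ cong (λ ys → last (filterᵇ p (upTo k) ++ ys)) (filterᵇ-[]-accept p k pw) ⟩
  last (filterᵇ p (upTo k) ∷ʳ k)                  ≡⟨ last-∷ʳ (filterᵇ p (upTo k)) k ⟩
  just k                                          ∎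
  where open ≡-Reasoning

-- Moves of the exclusion process on padded words

eqL-refl : ∀ a → eqL a a ≡ true
eqL-refl a = Equivalence.to T-≡ (fromWitness refl)

eqL⇒≡ : ∀ a b → eqL a b ≡ true → a ≡ b
eqL⇒≡ a b = toWitness ∘ Equivalence.from T-≡

pad : List Bool → List Bool
pad X = true ∷ X ∷ʳ false

unpad : ∀ X Z {z} → pad X ≡ true ∷ Z ∷ʳ z → X ≡ Z
unpad X Z = List.∷ʳ-injectiveˡ X Z ∘ List.∷-injectiveʳ

-- The pair •∘ between P and Q becomes •• if P = [] (injection), ∘∘ if Q = [] (ejection), and ∘• otherwise.
move : List Bool → List Bool → List Bool
move P Q = P ++ null P ∷ not (null Q) ∷ Q

MoveAt : List Bool → List Bool → List Bool → List Bool → Set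
MoveAt X Y P Q = pad X ≡ P ++ true ∷ false ∷ Q × pad Y ≡ move P Q

Allowed : List Bool → List Bool → Bool
Allowed X Y = isInj X Y ∨ isEj X Y ∨ isHop X Y

isHop-hop : ∀ A B → isHop (A ++ true ∷ false ∷ B) (A ++ false ∷ true ∷ B) ≡ true
isHop-hop []                B = eqL-refl B
isHop-hop (true ∷ [])       B = eqL-refl B
isHop-hop (true ∷ true ∷ A) B = isHop-hop (true ∷ A) B
isHop-hop (true ∷ false ∷ A) B = isHop-hop (false ∷ A) B
isHop-hop (false ∷ A)       B = isHop-hop A B

isEj-ej : ∀ A → isEj (A ∷ʳ true) (A ∷ʳ false) ≡ true
isEj-ej A rewrite List.reverse-++ A (true ∷ []) | List.reverse-++ A (false ∷ []) = eqL-refl (reverse A)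

allowed-inj : ∀ A → Allowed (false ∷ A) (true ∷ A) ≡ true
allowed-inj A rewrite eqL-refl A = refl

allowed-ej : ∀ A → Allowed (A ∷ʳ true) (A ∷ʳ false) ≡ true
allowed-ej A rewrite isEj-ej A = ∨-zeroʳ (isInj (A ∷ʳ true) (A ∷ʳ false))

allowed-hop : ∀ A B → Allowed (A ++ true ∷ false ∷ B) (A ++ false ∷ true ∷ B) ≡ true
allowed-hop A B rewrite isHop-hop A B
  | ∨-zeroʳ (isEj (A ++ true ∷ false ∷ B) (A ++ false ∷ true ∷ B)) = ∨-zeroʳ _

isInj-inv : ∀ X Y → isInj X Y ≡ true → ∃ λ A → X ≡ false ∷ A × Y ≡ true ∷ A
isInj-inv (false ∷ X) (true ∷ Y) e = X , refl , cong (true ∷_) (sym (eqL⇒≡ X Y e))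
isInj-inv []          _           ()
isInj-inv (true ∷ _)  _           ()
isInj-inv (false ∷ _) []          ()
isInj-inv (false ∷ _) (false ∷ _) ()

isEjRev-inv : ∀ u v → isEjRev u v ≡ true → ∃ λ a → u ≡ true ∷ a × v ≡ false ∷ a
isEjRev-inv (true ∷ u) (false ∷ v) e = u , refl , cong (false ∷_) (sym (eqL⇒≡ u v e))
isEjRev-inv []          _          ()
isEjRev-inv (false ∷ _) _          ()
isEjRev-inv (true ∷ _)  []         ()
isEjRev-inv (true ∷ _)  (true ∷ _) ()

isEj-inv : ∀ X Y → isEj X Y ≡ true → ∃ λ A → X ≡ A ∷ʳ true × Y ≡ A ∷ʳ false
isEj-inv X Y e with isEjRev-inv (reverse X) (reverse Y) e
... | a , X≡ , Y≡ = reverse a , unreverse X true X≡ , unreverse Y false Y≡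
  where
  unreverse : ∀ Z z → reverse Z ≡ z ∷ a → Z ≡ reverse a ∷ʳ z
  unreverse Z z e = trans (sym (List.reverse-involutive Z)) (trans (cong reverse e) (List.unfold-reverse z a))

HopShape : List Bool → List Bool → Set
HopShape X Y = ∃₂ λ A B → X ≡ A ++ true ∷ false ∷ B × Y ≡ A ++ false ∷ true ∷ B

hopShape-∷ : ∀ x {X Y} → HopShape X Y → HopShape (x ∷ X) (x ∷ Y)
hopShape-∷ x (A , B , refl , refl) = x ∷ A , B , refl , refl

isHop-inv : ∀ X Y → isHop X Y ≡ true → HopShape X Y
isHop-inv (true ∷ false ∷ X) (false ∷ true ∷ Y) e = [] , X , refl , cong (λ B → false ∷ true ∷ B) (sym (eqL⇒≡ X Y e))
isHop-inv (true ∷ true ∷ X)  (true ∷ Y)  e = hopShape-∷ true (isHop-inv (true ∷ X) Y e)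
isHop-inv (true ∷ false ∷ X) (true ∷ Y)  e = hopShape-∷ true (isHop-inv (false ∷ X) Y e)
isHop-inv (false ∷ X)        (false ∷ Y) e = hopShape-∷ false (isHop-inv X Y e)
isHop-inv []                 _                  ()
isHop-inv (false ∷ _)        []                 ()
isHop-inv (true ∷ [])        []                 ()
isHop-inv (true ∷ [])        (true ∷ _)         ()
isHop-inv (true ∷ [])        (false ∷ _)        ()
isHop-inv (true ∷ true ∷ _)  []                 ()
isHop-inv (true ∷ false ∷ _) []                 ()
isHop-inv (true ∷ true ∷ _)  (false ∷ _)        ()
isHop-inv (true ∷ false ∷ _) (false ∷ [])       ()
isHop-inv (true ∷ false ∷ _) (false ∷ false ∷ _) ()
isHop-inv (false ∷ _)        (true ∷ _)         ()

pad-++ : ∀ A xs → pad (A ++ xs) ≡ true ∷ A ++ xs ∷ʳ false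
pad-++ A xs = cong (true ∷_) (List.++-assoc A xs (false ∷ []))

moveAt⇒allowed : ∀ {X Y} P Q → X ≢ [] → MoveAt X Y P Q → Allowed X Y ≡ true
moveAt⇒allowed {[]}            []          _ X≢[] _      = ⊥-elim (X≢[] refl)
moveAt⇒allowed {true ∷ _}      []          _ _    (() , _)
moveAt⇒allowed {false ∷ X} {Y} []          _ _    (refl , padY) =
  subst (λ Y → Allowed (false ∷ X) Y ≡ true) (sym Y≡) (allowed-inj X)
  where
  Y≡ : Y ≡ true ∷ X
  Y≡ = unpad Y (true ∷ X) (trans padY (cong (λ b → true ∷ not b ∷ X ∷ʳ false) (null-∷ʳ X false)))
moveAt⇒allowed                 (false ∷ _) _ _    (() , _)
moveAt⇒allowed {X} {Y}         (true ∷ P)  Q _    (padX , padY) with initLast Q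
... | [] = subst₂ (λ X Y → Allowed X Y ≡ true) (sym X≡) (sym Y≡) (allowed-ej P)
  where
  X≡ : X ≡ P ∷ʳ true
  X≡ = unpad X (P ∷ʳ true) (trans padX (sym (pad-++ P (true ∷ []))))
  Y≡ : Y ≡ P ∷ʳ false
  Y≡ = unpad Y (P ∷ʳ false) (trans padY (sym (pad-++ P (false ∷ []))))
... | Q ∷ʳ′ z = subst₂ (λ X Y → Allowed X Y ≡ true) (sym X≡) (sym Y≡) (allowed-hop P Q)
  where
  X≡ : X ≡ P ++ true ∷ false ∷ Q
  X≡ = unpad X _ (trans padX (cong (true ∷_) (sym (List.++-assoc P (true ∷ false ∷ Q) (z ∷ [])))))
  Y≡ : Y ≡ P ++ false ∷ true ∷ Q
  Y≡ = unpad Y _ (trans padY (cong (true ∷_) (trans (cong (λ b → P ++ false ∷ not b ∷ Q ∷ʳ z) (null-∷ʳ Q z))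
                                                      (sym (List.++-assoc P (false ∷ true ∷ Q) (z ∷ []))))))

allowed⇒moveAt : ∀ X Y → Allowed X Y ≡ true → ∃₂ (MoveAt X Y)
allowed⇒moveAt X Y allowed with isInj X Y in inj | isEj X Y in ej
... | true | _ with isInj-inv X Y inj
...   | A , refl , refl = [] , A ∷ʳ false , refl , cong (λ b → true ∷ not b ∷ A ∷ʳ false) (sym (null-∷ʳ A false))
allowed⇒moveAt X Y allowed | false | true with isEj-inv X Y ej
...   | A , refl , refl = true ∷ A , [] , pad-++ A (true ∷ []) , pad-++ A (false ∷ [])
allowed⇒moveAt X Y allowed | false | false with isHop-inv X Y allowed
...   | A , B , refl , refl = true ∷ A , B ∷ʳ false , pad-++ A (true ∷ false ∷ B) ,
  trans (pad-++ A (false ∷ true ∷ B)) (cong (λ b → true ∷ A ++ false ∷ not b ∷ B ∷ʳ false) (sym (null-∷ʳ B false)))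

-- The later pair would have to lie in P, where pad Y agrees with pad X; so Q = [] and the later pair cannot fit.
moveAt-not-earlier : ∀ {X Y P Q P' Q'} → MoveAt X Y P Q → MoveAt X Y P' Q' → length P ℕ.< length P' → ⊥
moveAt-not-earlier {P = P} {Q} {P'} {Q'} (padX , _) (padX' , _) i<i' with ℕ.m≤n⇒m<n∨m≡n i<i'
... | inj₂ 1+i≡i' with trans (sym (at-++-∷-∷ P true false Q))
                        (trans (cong₂ at (trans (sym padX) padX') 1+i≡i') (at-++-∷ P' true (false ∷ Q')))
...   | ()
moveAt-not-earlier {P = P} {Q} {P'} {Q'} (padX , padY) (padX' , padY') i<i' | inj₁ 1+i<i' =
  ℕ.<⇒≱ i<i' (ℕ.≤-pred (ℕ.≤-pred (subst (suc i' ℕ.<_) length-S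
    (at⇒< (P' ++ true ∷ false ∷ Q') (suc i') (at-++-∷-∷ P' true false Q')))))
  where
  open ≡-Reasoning
  i i' : ℕ
  i = length P
  i' = length P'
  S≡ : P ++ true ∷ false ∷ Q ≡ P' ++ true ∷ false ∷ Q'
  S≡ = trans (sym padX) padX'
  Q-empty : just (not (null Q)) ≡ just false
  Q-empty = begin
    just (not (null Q))                  ≡⟨ sym (at-++-∷-∷ P (null P) (not (null Q)) Q) ⟩
    at (move P Q) (suc i)                ≡⟨ cong (λ T → at T (suc i)) (trans (sym padY) padY') ⟩
    at (move P' Q') (suc i)              ≡⟨ at-++ˡ P' _ 1+i<i' ⟩
    at P' (suc i)                        ≡⟨ sym (at-++ˡ P' _ 1+i<i') ⟩
    at (P' ++ true ∷ false ∷ Q') (suc i) ≡⟨ cong (λ S → at S (suc i)) (sym S≡) ⟩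
    at (P ++ true ∷ false ∷ Q) (suc i)   ≡⟨ at-++-∷-∷ P true false Q ⟩
    just false                           ∎
  Q≡[] : ∀ Q → just (not (null Q)) ≡ just false → Q ≡ []
  Q≡[] [] _ = refl
  length-S : length (P' ++ true ∷ false ∷ Q') ≡ suc (suc i)
  length-S = begin
    length (P' ++ true ∷ false ∷ Q') ≡⟨ cong length (sym S≡) ⟩
    length (P ++ true ∷ false ∷ Q)   ≡⟨ cong (λ Q → length (P ++ true ∷ false ∷ Q)) (Q≡[] Q Q-empty) ⟩
    length (P ++ true ∷ false ∷ [])  ≡⟨ List.length-++ P ⟩
    i + 2                            ≡⟨ ℕ.+-comm i 2 ⟩
    suc (suc i)                      ∎

moveAt-unique : ∀ {X Y P Q P' Q'} → MoveAt X Y P Q → MoveAt X Y P' Q' → length P ≡ length P'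
moveAt-unique {P = P} {P' = P'} mv mv' with ℕ.<-cmp (length P) (length P')
... | tri< i<i' _ _ = ⊥-elim (moveAt-not-earlier mv mv' i<i')
... | tri≈ _ i≡i' _ = i≡i'
... | tri> _ _ i'<i = ⊥-elim (moveAt-not-earlier mv' mv i'<i)

W-disallowed : ∀ α β {n} (X Y : Config n) → Allowed (toList X) (toList Y) ≡ false → W α β X Y ≡ 0ℚ
W-disallowed α β X Y disallowed with isInj (toList X) (toList Y) | isEj (toList X) (toList Y) | isHop (toList X) (toList Y)
W-disallowed α β X Y refl | false | false | false = refl

W≢0⇒allowed : ∀ α β {n} (X Y : Config n) → W α β X Y ≢ 0ℚ → Allowed (toList X) (toList Y) ≡ true
W≢0⇒allowed α β X Y W≢0 with Allowed (toList X) (toList Y) in allowed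
... | true  = refl
... | false = ⊥-elim (W≢0 (W-disallowed α β X Y allowed))

allowed⇒W≢0 : ∀ {α β n} (X Y : Config n) → α ≢ 0ℚ → β ≢ 0ℚ →
              Allowed (toList X) (toList Y) ≡ true → W α β X Y ≢ 0ℚ
allowed⇒W≢0 X Y α≢0 β≢0 allowed with isInj (toList X) (toList Y) | isEj (toList X) (toList Y) | isHop (toList X) (toList Y)
... | true  | _     | _    = α≢0
... | false | true  | _    = β≢0
... | false | false | true = λ ()

W-1-1-allowed : ∀ {n} (X Y : Config n) → Allowed (toList X) (toList Y) ≡ true → W 1ℚ 1ℚ X Y ≡ 1ℚ
W-1-1-allowed X Y allowed with isInj (toList X) (toList Y) | isEj (toList X) (toList Y) | isHop (toList X) (toList Y)
... | true  | _     | _    = refl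
... | false | true  | _    = refl
... | false | false | true = refl

-- Trees and their side words

length-sidesAt : ∀ b t → length (sidesAt b t) ≡ leaves t
length-sidesAt b leaf       = refl
length-sidesAt b (node l r) =
  trans (List.length-++ (sidesAt true l)) (cong₂ _+_ (length-sidesAt true l) (length-sidesAt false r))

sidesAt-expand : ∀ b t {j} → j ℕ.< leaves t → sidesAt b (f (expand t j)) ≡ expandWord (sidesAt b t) j
sidesAt-expand b leaf       {zero} _  = refl
sidesAt-expand b leaf       {suc j} (s≤s ())
sidesAt-expand b (node l r) {j}    j< with j <ᵇ leaves l in j<?l
... | true = begin
  sidesAt true (f (expand l j)) ++ B ≡⟨ cong (_++ B) (sidesAt-expand true l j<l) ⟩
  expandWord A j ++ B               ≡⟨ sym (expandWord-++ˡ A B (subst (j ℕ.<_) (sym (length-sidesAt true l)) j<l)) ⟩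
  expandWord (A ++ B) j             ∎
  where
  open ≡-Reasoning
  A B : List Bool
  A = sidesAt true l
  B = sidesAt false r
  j<l : j ℕ.< leaves l
  j<l = <ᵇ≡true⇒< j<?l
... | false = begin
  A ++ sidesAt false (f (expand r d)) ≡⟨ cong (A ++_) (sidesAt-expand false r d<r) ⟩
  A ++ expandWord B d                 ≡⟨ sym (expandWord-++ʳ A B d) ⟩
  expandWord (A ++ B) (length A + d)  ≡⟨ cong (λ k → expandWord (A ++ B) (k + d)) (length-sidesAt true l) ⟩
  expandWord (A ++ B) (leaves l + d)  ≡⟨ cong (expandWord (A ++ B)) (ℕ.m+[n∸m]≡n l≤j) ⟩
  expandWord (A ++ B) j               ∎
  where
  open ≡-Reasoning
  A B : List Bool
  A = sidesAt true l
  B = sidesAt false r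
  d : ℕ
  d = j ∸ leaves l
  l≤j : leaves l ≤ j
  l≤j = <ᵇ≡false⇒≥ j<?l
  d<r : d ℕ.< leaves r
  d<r = ℕ.+-cancelˡ-< (leaves l) d (leaves r) (subst (ℕ._< leaves l + leaves r) (sym (ℕ.m+[n∸m]≡n l≤j)) j<)

sides≡sidesAt : ∀ {t} → t ≢ leaf → sides t ≡ sidesAt true t
sides≡sidesAt {leaf}     t≢leaf = ⊥-elim (t≢leaf refl)
sides≡sidesAt {node _ _} _      = refl

sidesAt-true-∷ : ∀ t → ∃ λ Z → sidesAt true t ≡ true ∷ Z
sidesAt-true-∷ leaf       = [] , refl
sidesAt-true-∷ (node l r) with sidesAt-true-∷ l
... | Z , e = Z ++ sidesAt false r , cong (_++ sidesAt false r) e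

sidesAt-false-∷ʳ : ∀ t → ∃ λ Z → sidesAt false t ≡ Z ∷ʳ false
sidesAt-false-∷ʳ leaf       = [] , refl
sidesAt-false-∷ʳ (node l r) with sidesAt-false-∷ʳ r
... | Z , e = sidesAt true l ++ Z , trans (cong (sidesAt true l ++_) e) (sym (List.++-assoc (sidesAt true l) Z _))

sidesAt-node : ∀ b l r → ∃ λ Z → sidesAt b (node l r) ≡ pad Z
sidesAt-node b l r with sidesAt-true-∷ l | sidesAt-false-∷ʳ r
... | Zl , el | Zr , er = Zl ++ Zr , trans (cong₂ _++_ el er) (cong (true ∷_) (sym (List.++-assoc Zl Zr _)))

R-pad : ∀ T X → sides T ≡ pad X → R T ≡ X
R-pad T X e rewrite e | length-∷ʳ X false = take-length-++ X (false ∷ [])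

sides≡pad-R : ∀ {T} → T ≢ leaf → sides T ≡ pad (R T)
sides≡pad-R {leaf}     T≢leaf = ⊥-elim (T≢leaf refl)
sides≡pad-R {node l r} _ with sidesAt-node true l r
... | Z , e = trans e (cong pad (sym (R-pad (node l r) Z e)))

leaves≡+2⇒≢leaf : ∀ {T} n → leaves T ≡ n + 2 → T ≢ leaf
leaves≡+2⇒≢leaf n e refl with trans e (ℕ.+-comm n 2)
... | ()

treeOf : List Bool → Tree
treeOf []          = node leaf leaf
treeOf (true ∷ X)  = node leaf (treeOf X)
treeOf (false ∷ X) = f (expand (treeOf X) 0)

sidesAt-treeOf : ∀ b X → sidesAt b (treeOf X) ≡ pad X
sidesAt-treeOf b []          = refl
sidesAt-treeOf b (true ∷ X)  = cong (true ∷_) (sidesAt-treeOf false X)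
sidesAt-treeOf b (false ∷ X) = begin
  sidesAt b (f (expand (treeOf X) 0)) ≡⟨ sidesAt-expand b (treeOf X) 0<leaves ⟩
  expandWord (sidesAt b (treeOf X)) 0  ≡⟨ cong (λ s → expandWord s 0) (sidesAt-treeOf b X) ⟩
  pad (false ∷ X)                      ∎
  where
  open ≡-Reasoning
  0<leaves : 0 ℕ.< leaves (treeOf X)
  0<leaves = subst (0 ℕ.<_) (trans (cong length (sym (sidesAt-treeOf b X))) (length-sidesAt b (treeOf X))) (s≤s z≤n)

leaves-treeOf : ∀ X → leaves (treeOf X) ≡ length X + 2
leaves-treeOf X = begin
  leaves (treeOf X)              ≡⟨ sym (length-sidesAt true (treeOf X)) ⟩
  length (sidesAt true (treeOf X)) ≡⟨ cong length (sidesAt-treeOf true X) ⟩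
  suc (length (X ∷ʳ false))      ≡⟨ cong suc (length-∷ʳ X false) ⟩
  2 + length X                   ≡⟨ ℕ.+-comm 2 (length X) ⟩
  length X + 2                   ∎
  where open ≡-Reasoning

R-treeOf : ∀ X → R (treeOf X) ≡ X
R-treeOf X = R-pad (treeOf X) X
  (trans (sides≡sidesAt {treeOf X} (leaves≡+2⇒≢leaf (length X) (leaves-treeOf X))) (sidesAt-treeOf true X))

-- Marked trees

leftSides rightSides : MTree → List Bool
leftSides cherry    = []
leftSides (inL m t) = leftSides m
leftSides (inR t m) = sidesAt true t ++ leftSides m
rightSides cherry    = []
rightSides (inL m t) = rightSides m ++ sidesAt false t
rightSides (inR t m) = rightSides m

-- The side of v, when the root of the marked tree is a descendent on side b.
markedSide : Bool → MTree → Bool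
markedSide b cherry    = b
markedSide _ (inL m t) = markedSide true m
markedSide _ (inR t m) = markedSide false m

sidesAt-f : ∀ b m → sidesAt b (f m) ≡ leftSides m ++ true ∷ false ∷ rightSides m
sidesAt-f b cherry    = refl
sidesAt-f b (inL m t) = trans (cong (_++ sidesAt false t) (sidesAt-f true m))
                              (List.++-assoc (leftSides m) (true ∷ false ∷ rightSides m) (sidesAt false t))
sidesAt-f b (inR t m) = trans (cong (sidesAt true t ++_) (sidesAt-f false m))
                              (sym (List.++-assoc (sidesAt true t) (leftSides m) (true ∷ false ∷ rightSides m)))

sidesAt-contract : ∀ b m → sidesAt b (contract m) ≡ leftSides m ++ markedSide b m ∷ rightSides m
sidesAt-contract b cherry    = refl
sidesAt-contract b (inL m t) = trans (cong (_++ sidesAt false t) (sidesAt-contract true m))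
                                     (List.++-assoc (leftSides m) (markedSide true m ∷ rightSides m) (sidesAt false t))
sidesAt-contract b (inR t m) = trans (cong (sidesAt true t ++_) (sidesAt-contract false m))
                                     (sym (List.++-assoc (sidesAt true t) (leftSides m) (markedSide false m ∷ rightSides m)))

length-leftSides : ∀ m → length (leftSides m) ≡ idx m
length-leftSides cherry    = refl
length-leftSides (inL m t) = length-leftSides m
length-leftSides (inR t m) = trans (List.length-++ (sidesAt true t)) (cong₂ _+_ (length-sidesAt true t) (length-leftSides m))

sideOf-inL : ∀ m t → sideOf (inL m t) ≡ just (markedSide true m)
sideOf-inR : ∀ t m → sideOf (inR t m) ≡ just (markedSide false m)
sideOf-inL cherry     t = refl
sideOf-inL (inL m t') t = sideOf-inL m t'
sideOf-inL (inR t' m) t = sideOf-inR t' m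
sideOf-inR t cherry     = refl
sideOf-inR t (inL m t') = sideOf-inL m t'
sideOf-inR t (inR t' m) = sideOf-inR t' m

f≢leaf : ∀ m → f m ≢ leaf
f≢leaf cherry    ()
f≢leaf (inL m t) ()
f≢leaf (inR t m) ()

idx<leaves : ∀ m → idx m ℕ.< leaves (f m)
idx<leaves cherry    = s≤s z≤n
idx<leaves (inL m t) = ℕ.<-≤-trans (idx<leaves m) (ℕ.m≤m+n (leaves (f m)) (leaves t))
idx<leaves (inR t m) = ℕ.+-monoʳ-< (leaves t) (idx<leaves m)

node-injective : ∀ {l l' r r'} → node l r ≡ node l' r' → l ≡ l' × r ≡ r'
node-injective refl = refl , refl

mark-unique : ∀ m m' → f m ≡ f m' → idx m ≡ idx m' → m ≡ m'
mark-unique cherry    cherry     _ _ = refl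
mark-unique cherry    (inL m t)  e _ = ⊥-elim (f≢leaf m (sym (proj₁ (node-injective e))))
mark-unique cherry    (inR t m)  e _ = ⊥-elim (f≢leaf m (sym (proj₂ (node-injective e))))
mark-unique (inL m t) cherry     e _ = ⊥-elim (f≢leaf m (proj₁ (node-injective e)))
mark-unique (inR t m) cherry     e _ = ⊥-elim (f≢leaf m (proj₂ (node-injective e)))
mark-unique (inL m t) (inL m' t') e i with node-injective e
... | fm≡ , refl = cong (λ m → inL m t) (mark-unique m m' fm≡ i)
mark-unique (inR t m) (inR t' m') e i with node-injective e
... | refl , fm≡ = cong (inR t) (mark-unique m m' fm≡ (ℕ.+-cancelˡ-≡ (leaves t) _ _ i))
mark-unique (inL m t) (inR t' m') e i =
  ⊥-elim (ℕ.<-irrefl i (ℕ.<-≤-trans (subst (λ T → idx m ℕ.< leaves T) (proj₁ (node-injective e)) (idx<leaves m))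
                                    (ℕ.m≤m+n (leaves t') (idx m'))))
mark-unique (inR t m) (inL m' t') e i = sym (mark-unique (inL m' t') (inR t m) (sym e) (sym i))

at-sidesAt-node-left : ∀ b l r {j} → j ℕ.< leaves l → at (sidesAt b (node l r)) j ≡ at (sidesAt true l) j
at-sidesAt-node-left b l r j<l = at-++ˡ (sidesAt true l) (sidesAt false r) (subst (_ ℕ.<_) (sym (length-sidesAt true l)) j<l)

at-sidesAt-node-right : ∀ b l r d → at (sidesAt b (node l r)) (leaves l + d) ≡ at (sidesAt false r) d
at-sidesAt-node-right b l r d =
  trans (cong (λ k → at (sidesAt true l ++ sidesAt false r) (k + d)) (sym (length-sidesAt true l)))
        (at-++ʳ (sidesAt true l) (sidesAt false r) d)

-- An occurrence of •∘ across the root of node l r: the last endpoint of l is a left descendent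
-- only if l is a leaf, and the first endpoint of r a right descendent only if r is a leaf.
markAt-root : ∀ b l r j → suc j ≡ leaves l → at (sidesAt b (node l r)) j ≡ just true →
              at (sidesAt b (node l r)) (suc j) ≡ just false → ∃ λ m → f m ≡ node l r × idx m ≡ j
markAt-root b leaf leaf zero _ _ _ = cherry , refl , refl
markAt-root b leaf (node r₁ r₂) zero _ _ e₂ with sidesAt-node false r₁ r₂
... | Z , e with trans (sym e₂) (cong (λ s → at s 0) e)
...   | ()
markAt-root b (node l₁ r₁) r j 1+j≡l e₁ _ with sidesAt-node true l₁ r₁
... | Z , e with trans (sym e₁) (trans (at-sidesAt-node-left b (node l₁ r₁) r j<l) (trans (cong₂ at e j≡) (at-++-∷ Z false [])))
  where
  j<l : j ℕ.< leaves (node l₁ r₁)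
  j<l = subst (j ℕ.<_) 1+j≡l ℕ.≤-refl
  j≡ : j ≡ suc (length Z)
  j≡ = ℕ.suc-injective (begin
    suc j                                  ≡⟨ 1+j≡l ⟩
    leaves (node l₁ r₁)                    ≡⟨ sym (length-sidesAt true (node l₁ r₁)) ⟩
    length (sidesAt true (node l₁ r₁))     ≡⟨ cong length e ⟩
    suc (length (Z ∷ʳ false))              ≡⟨ cong suc (length-∷ʳ Z false) ⟩
    suc (suc (length Z))                   ∎)
    where open ≡-Reasoning
...   | ()

markAt : ∀ b T j → at (sidesAt b T) j ≡ just true → at (sidesAt b T) (suc j) ≡ just false →
         ∃ λ m → f m ≡ T × idx m ≡ j
markAt b leaf       j _  ()
markAt b (node l r) j e₁ e₂ with ℕ.<-cmp (suc j) (leaves l)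
... | tri< 1+j<l _ _ with markAt true l j (trans (sym (at-sidesAt-node-left b l r (ℕ.<-trans (ℕ.n<1+n j) 1+j<l))) e₁)
                                          (trans (sym (at-sidesAt-node-left b l r 1+j<l)) e₂)
...   | m , refl , refl = inL m r , refl , refl
markAt b (node l r) j e₁ e₂ | tri≈ _ 1+j≡l _ = markAt-root b l r j 1+j≡l e₁ e₂
markAt b (node l r) j e₁ e₂ | tri> _ _ l<1+j with ℕ.m≤n⇒∃[o]m+o≡n (ℕ.≤-pred l<1+j)
...   | d , refl with markAt false r d (trans (sym (at-sidesAt-node-right b l r d)) e₁)
                          (trans (sym (at-sidesAt-node-right b l r (suc d)))
                                 (subst (λ k → at (sidesAt b (node l r)) k ≡ just false) (sym (ℕ.+-suc (leaves l) d)) e₂))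
...     | m , refl , refl = inR l m , refl , refl

-- The map π

-- The local function pick of chooseW, for v on side x, with s the side word of the contracted tree and i the index of v'.
choice : Bool → List Bool → ℕ → ℕ
choice false s i = fromMaybe 0
  (if suc i <ᵇ length s
   then head (filterᵇ (λ j → (i <ᵇ j) ∧ isSide false (at s j)) (upTo (length s)))
   else last (filterᵇ (λ j → isSide true (at s j)) (upTo (length s))))
choice true s i = fromMaybe 0
  (if 0 <ᵇ i
   then last (filterᵇ (λ j → (j <ᵇ i) ∧ isSide true (at s j)) (upTo (length s)))
   else head (filterᵇ (λ j → isSide false (at s j)) (upTo (length s))))

chooseW≡choice : ∀ m {x} → sideOf m ≡ just x → chooseW m ≡ choice x (sides (contract m)) (idx m)
chooseW≡choice m e with sideOf m
chooseW≡choice m refl | just true  = refl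
chooseW≡choice m refl | just false = refl

choice-false-∷ : ∀ P {Q a} → FirstFalseAt Q a → choice false (P ++ false ∷ Q) (length P) ≡ length P + suc a
choice-false-∷ P {Q} {a} ff = begin
  choice false s i                         ≡⟨ cong (λ c → fromMaybe 0 (if c then found else other)) cond ⟩
  fromMaybe 0 (head (filterᵇ p (upTo (length s)))) ≡⟨ cong (fromMaybe 0) (head-filterᵇ-upTo p w<len pw before) ⟩
  i + suc a                                ∎
  where
  open ≡-Reasoning
  s : List Bool
  s = P ++ false ∷ Q
  i : ℕ
  i = length P
  p : ℕ → Bool
  p j = (i <ᵇ j) ∧ isSide false (at s j)
  found other : Maybe ℕ
  found = head (filterᵇ p (upTo (length s)))
  other = last (filterᵇ (λ j → isSide true (at s j)) (upTo (length s)))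
  w<len : i + suc a ℕ.< length s
  w<len = subst (i + suc a ℕ.<_) (sym (List.length-++ P)) (ℕ.+-monoʳ-< i (s≤s (firstFalse< ff)))
  cond : (suc i <ᵇ length s) ≡ true
  cond = <⇒<ᵇ≡true (ℕ.≤-<-trans (ℕ.m<m+n i (s≤s z≤n)) w<len)
  pw : p (i + suc a) ≡ true
  pw rewrite <⇒<ᵇ≡true (ℕ.m<m+n i {suc a} (s≤s z≤n)) | at-++ʳ P (false ∷ Q) (suc a) | at-firstFalse ff = refl
  before : ∀ {j} → j ℕ.< i + suc a → p j ≡ false
  before {j} j< with i <ᵇ j in i<j
  ... | false = refl
  ... | true with <⇒≡+suc {i} {j} (<ᵇ≡true⇒< i<j)
  ...   | d , refl rewrite at-++ʳ P (false ∷ Q) (suc d)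
                         | at-before-firstFalse ff (ℕ.≤-pred (ℕ.+-cancelˡ-< i (suc d) (suc a) j<)) = refl

choice-false-[] : ∀ {P b} → LastTrueAt P b → choice false (P ∷ʳ false) (length P) ≡ b
choice-false-[] {P} {b} lt = begin
  choice false s i                         ≡⟨ cong (λ c → fromMaybe 0 (if c then other else found)) cond ⟩
  fromMaybe 0 (last (filterᵇ p (upTo (length s)))) ≡⟨ cong (fromMaybe 0) (last-filterᵇ-upTo p b<len pb after) ⟩
  b                                        ∎
  where
  open ≡-Reasoning
  s : List Bool
  s = P ∷ʳ false
  i : ℕ
  i = length P
  p : ℕ → Bool
  p j = isSide true (at s j)
  found other : Maybe ℕ
  found = last (filterᵇ p (upTo (length s)))
  other = head (filterᵇ (λ j → (i <ᵇ j) ∧ isSide false (at s j)) (upTo (length s)))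
  cond : (suc i <ᵇ length s) ≡ false
  cond = ≤⇒<ᵇ≡false (ℕ.≤-reflexive (length-∷ʳ P false))
  atb : at s b ≡ just true
  atb = trans (at-++ˡ P (false ∷ []) (lastTrue< lt)) (at-lastTrue lt)
  b<len : b ℕ.< length s
  b<len = at⇒< s b atb
  pb : p b ≡ true
  pb rewrite atb = refl
  after : ∀ {j} → b ℕ.< j → j ℕ.< length s → p j ≡ false
  after {j} b<j j<len with ℕ.m<1+n⇒m<n∨m≡n (subst (j ℕ.<_) (length-∷ʳ P false) j<len)
  ... | inj₁ j<i  rewrite at-++ˡ P (false ∷ []) j<i | at-after-lastTrue lt b<j j<i = refl
  ... | inj₂ refl rewrite at-++-∷ P false [] = refl

choice-true-∷ : ∀ {P b} Q → LastTrueAt P b → choice true (P ++ true ∷ Q) (length P) ≡ b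
choice-true-∷ {P} {b} Q lt = begin
  choice true s i                          ≡⟨ cong (λ c → fromMaybe 0 (if c then found else other)) cond ⟩
  fromMaybe 0 (last (filterᵇ p (upTo (length s)))) ≡⟨ cong (fromMaybe 0) (last-filterᵇ-upTo p b<len pb after) ⟩
  b                                        ∎
  where
  open ≡-Reasoning
  s : List Bool
  s = P ++ true ∷ Q
  i : ℕ
  i = length P
  p : ℕ → Bool
  p j = (j <ᵇ i) ∧ isSide true (at s j)
  found other : Maybe ℕ
  found = last (filterᵇ p (upTo (length s)))
  other = head (filterᵇ (λ j → isSide false (at s j)) (upTo (length s)))
  cond : (0 <ᵇ i) ≡ true
  cond = <⇒<ᵇ≡true (ℕ.≤-<-trans z≤n (lastTrue< lt))
  atb : at s b ≡ just true
  atb = trans (at-++ˡ P (true ∷ Q) (lastTrue< lt)) (at-lastTrue lt)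
  b<len : b ℕ.< length s
  b<len = at⇒< s b atb
  pb : p b ≡ true
  pb rewrite <⇒<ᵇ≡true (lastTrue< lt) | atb = refl
  after : ∀ {j} → b ℕ.< j → j ℕ.< length s → p j ≡ false
  after {j} b<j _ with j <ᵇ i in j<i
  ... | false = refl
  ... | true rewrite at-++ˡ P (true ∷ Q) (<ᵇ≡true⇒< j<i) | at-after-lastTrue lt b<j (<ᵇ≡true⇒< j<i) = refl

choice-true-[] : ∀ {Q a} → FirstFalseAt Q a → choice true (true ∷ Q) 0 ≡ suc a
choice-true-[] {Q} {a} ff = cong (fromMaybe 0) (head-filterᵇ-upTo p (s≤s (firstFalse< ff)) pw before)
  where
  p : ℕ → Bool
  p j = isSide false (at (true ∷ Q) j)
  pw : p (suc a) ≡ true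
  pw rewrite at-firstFalse ff = refl
  before : ∀ {j} → j ℕ.< suc a → p j ≡ false
  before {zero}  _        = refl
  before {suc j} (s≤s j<) rewrite at-before-firstFalse ff j< = refl

expandWord-lastTrue-++ : ∀ {P b} ys → LastTrueAt P b → expandWord (P ++ ys) b ≡ P ++ false ∷ ys
expandWord-lastTrue-++ {P} {b} ys lt = begin
  expandWord (P ++ ys) b  ≡⟨ expandWord-++ˡ P ys (lastTrue< lt) ⟩
  expandWord P b ++ ys    ≡⟨ cong (_++ ys) (expandWord-lastTrue lt) ⟩
  P ∷ʳ false ++ ys        ≡⟨ List.++-assoc P (false ∷ []) ys ⟩
  P ++ false ∷ ys         ∎
  where open ≡-Reasoning

lastTrue<-++ : ∀ {P b} ys → LastTrueAt P b → b ℕ.< length (P ++ ys)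
lastTrue<-++ {P} ys lt = ℕ.<-≤-trans (lastTrue< lt) (List.length-++-≤ˡ P)

expandWord-choice : ∀ P x Q → head (P ++ x ∷ Q) ≡ just true → last (P ++ x ∷ Q) ≡ just false →
  let w = choice x (P ++ x ∷ Q) (length P) in w ℕ.< length (P ++ x ∷ Q) × expandWord (P ++ x ∷ Q) w ≡ move P Q
expandWord-choice []          false _       () _
expandWord-choice (false ∷ _) _     _       () _
expandWord-choice []          true  []      _  ()
expandWord-choice []          true  (q ∷ Q) _  lst with firstFalse-last (q ∷ Q) lst
... | a , ff rewrite choice-true-[] ff = s≤s (firstFalse< ff) , cong (true ∷_) (expandWord-firstFalse ff)
expandWord-choice (true ∷ P)  false []      _  _ with lastTrue-∷ P
... | b , lt rewrite choice-false-[] lt = lastTrue<-++ (false ∷ []) lt , expandWord-lastTrue-++ (false ∷ []) lt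
expandWord-choice (true ∷ P)  false (q ∷ Q) _  lst
  with firstFalse-last (q ∷ Q) (trans (sym (last-++-∷ (true ∷ P) false (q ∷ Q))) lst)
... | a , ff rewrite choice-false-∷ (true ∷ P) ff =
  subst (length (true ∷ P) + suc a ℕ.<_) (sym (List.length-++ (true ∷ P)))
        (ℕ.+-monoʳ-< (length (true ∷ P)) (s≤s (firstFalse< ff))) ,
  trans (expandWord-++ʳ (true ∷ P) (false ∷ q ∷ Q) (suc a))
        (cong (λ Q′ → (true ∷ P) ++ false ∷ Q′) (expandWord-firstFalse ff))
expandWord-choice (true ∷ P)  true  []      _  lst with trans (sym (last-++-∷ (true ∷ P) true [])) lst
... | ()
expandWord-choice (true ∷ P)  true  (q ∷ Q) _  _ with lastTrue-∷ P
... | b , lt rewrite choice-true-∷ (q ∷ Q) lt = lastTrue<-++ (true ∷ q ∷ Q) lt , expandWord-lastTrue-++ (true ∷ q ∷ Q) lt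

sides-π-nonroot : ∀ m → contract m ≢ leaf → sideOf m ≡ just (markedSide true m) →
                  sides (f (π m)) ≡ move (leftSides m) (rightSides m)
sides-π-nonroot m c≢leaf side = begin
  sides (f (π m))                         ≡⟨ sides≡sidesAt (f≢leaf (π m)) ⟩
  sidesAt true (f (expand (contract m) w)) ≡⟨ sidesAt-expand true (contract m) w<leaves ⟩
  expandWord (sidesAt true (contract m)) w ≡⟨ cong₂ expandWord S≡ w≡ ⟩
  expandWord S (choice x S (length P))    ≡⟨ proj₂ chosen ⟩
  move P Q                                ∎
  where
  open ≡-Reasoning
  x : Bool
  x = markedSide true m
  P Q S : List Bool
  P = leftSides m
  Q = rightSides m
  S = P ++ x ∷ Q
  w : ℕ
  w = chooseW m
  S≡ : sidesAt true (contract m) ≡ S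
  S≡ = sidesAt-contract true m
  S≡pad : S ≡ pad (R (contract m))
  S≡pad = trans (sym S≡) (trans (sym (sides≡sidesAt c≢leaf)) (sides≡pad-R c≢leaf))
  chosen : choice x S (length P) ℕ.< length S × expandWord S (choice x S (length P)) ≡ move P Q
  chosen = expandWord-choice P x Q (cong head S≡pad) (trans (cong last S≡pad) (last-∷ʳ (true ∷ R (contract m)) false))
  w≡ : w ≡ choice x S (length P)
  w≡ = trans (chooseW≡choice m side)
             (cong₂ (choice x) (trans (sides≡sidesAt c≢leaf) S≡) (sym (length-leftSides m)))
  w<leaves : w ℕ.< leaves (contract m)
  w<leaves = subst₂ ℕ._<_ (sym w≡) (trans (cong length (sym S≡)) (length-sidesAt true (contract m))) (proj₁ chosen)

sides-π : ∀ m → m ≢ cherry → sides (f (π m)) ≡ move (leftSides m) (rightSides m)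
sides-π cherry    m≢cherry = ⊥-elim (m≢cherry refl)
sides-π (inL m t) _        = sides-π-nonroot (inL m t) (λ ()) (sideOf-inL m t)
sides-π (inR t m) _        = sides-π-nonroot (inR t m) (λ ()) (sideOf-inR t m)

-- The bijection between 𝓕(C' → C) and R⁻¹{C'}

Rinv-inhabited : ∀ n (C' : Config n) → Rinv n C'
Rinv-inhabited n C' = (treeOf X , trans (leaves-treeOf X) (cong (_+ 2) (length-toList C'))) , R-treeOf X
  where
  X : List Bool
  X = toList C'

module _ {n} (1≤n : 1 ≤ n) (C' C : Config n) where

  private
    X Y : List Bool
    X = toList C'
    Y = toList C

    n≢0 : n ≢ 0
    n≢0 n≡0 with subst (1 ≤_) n≡0 1≤n
    ... | ()

    X≢[] : X ≢ []
    X≢[] X≡[] = n≢0 (trans (sym (length-toList C')) (cong length X≡[]))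

    ≢cherry : ∀ {m} → leaves (f m) ≡ n + 2 → m ≢ cherry
    ≢cherry 2≡n+2 refl = n≢0 (ℕ.suc-injective (ℕ.suc-injective (sym (trans 2≡n+2 (ℕ.+-comm n 2)))))

  𝓕⇒moveAt : (x : 𝓕 n C' C) → let m = proj₁ (proj₁ x) in MoveAt X Y (leftSides m) (rightSides m)
  𝓕⇒moveAt ((m , leaves≡) , R≡X , R≡Y) = padX , padY
    where
    open ≡-Reasoning
    padX : pad X ≡ leftSides m ++ true ∷ false ∷ rightSides m
    padX = begin
      pad X              ≡⟨ cong pad (sym R≡X) ⟩
      pad (R (f m))      ≡⟨ sym (sides≡pad-R (f≢leaf m)) ⟩
      sides (f m)        ≡⟨ sides≡sidesAt (f≢leaf m) ⟩
      sidesAt true (f m) ≡⟨ sidesAt-f true m ⟩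
      leftSides m ++ true ∷ false ∷ rightSides m ∎
    padY : pad Y ≡ move (leftSides m) (rightSides m)
    padY = begin
      pad Y              ≡⟨ cong pad (sym R≡Y) ⟩
      pad (R (f (π m)))  ≡⟨ sym (sides≡pad-R (f≢leaf (π m))) ⟩
      sides (f (π m))    ≡⟨ sides-π m (≢cherry leaves≡) ⟩
      move (leftSides m) (rightSides m) ∎

  𝓕⇒allowed : 𝓕 n C' C → Allowed X Y ≡ true
  𝓕⇒allowed x = moveAt⇒allowed _ _ X≢[] (𝓕⇒moveAt x)

  forget : 𝓕 n C' C → Rinv n C'
  forget ((m , leaves≡) , R≡X , _) = (f m , leaves≡) , R≡X

  Rinv-≡ : ∀ {y y' : Rinv n C'} → proj₁ (proj₁ y) ≡ proj₁ (proj₁ y') → y ≡ y'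
  Rinv-≡ {(T , l) , r} {(.T , l') , r'} refl = cong₂ (λ l r → (T , l) , r) (ℕ.≡-irrelevant l l') (≡-irrelevantᴸ r r')

  𝓕-≡ : ∀ {x x' : 𝓕 n C' C} → proj₁ (proj₁ x) ≡ proj₁ (proj₁ x') → x ≡ x'
  𝓕-≡ {(m , l) , r₁ , r₂} {(.m , l') , r₁' , r₂'} refl
    rewrite ℕ.≡-irrelevant l l' | ≡-irrelevantᴸ r₁ r₁' | ≡-irrelevantᴸ r₂ r₂' = refl

  module _ {P Q} (mv : MoveAt X Y P Q) where

    sidesAt-Rinv : (y : Rinv n C') → sidesAt true (proj₁ (proj₁ y)) ≡ P ++ true ∷ false ∷ Q
    sidesAt-Rinv ((T , leaves≡) , R≡X) = begin
      sidesAt true T ≡⟨ sym (sides≡sidesAt T≢leaf) ⟩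
      sides T        ≡⟨ sides≡pad-R T≢leaf ⟩
      pad (R T)      ≡⟨ cong pad R≡X ⟩
      pad X          ≡⟨ proj₁ mv ⟩
      P ++ true ∷ false ∷ Q ∎
      where
      open ≡-Reasoning
      T≢leaf : T ≢ leaf
      T≢leaf = leaves≡+2⇒≢leaf n leaves≡

    markRinv : (y : Rinv n C') → ∃ λ m → f m ≡ proj₁ (proj₁ y) × idx m ≡ length P
    markRinv y = markAt true _ (length P)
      (trans (cong (λ s → at s (length P)) (sidesAt-Rinv y)) (at-++-∷ P true (false ∷ Q)))
      (trans (cong (λ s → at s (suc (length P))) (sidesAt-Rinv y)) (at-++-∷-∷ P true false Q))

    mark : Rinv n C' → 𝓕 n C' C
    mark y@((T , leaves≡) , R≡X) = (m , leaves≡′) , trans (cong R fm≡T) R≡X , R-pad (f (π m)) Y sides≡padY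
      where
      m : MTree
      m = proj₁ (markRinv y)
      fm≡T : f m ≡ T
      fm≡T = proj₁ (proj₂ (markRinv y))
      leaves≡′ : leaves (f m) ≡ n + 2
      leaves≡′ = trans (cong leaves fm≡T) leaves≡
      split : leftSides m ≡ P × true ∷ false ∷ rightSides m ≡ true ∷ false ∷ Q
      split = ++-injective (leftSides m) P (trans (length-leftSides m) (proj₂ (proj₂ (markRinv y))))
        (trans (sym (sidesAt-f true m)) (trans (cong (sidesAt true) fm≡T) (sidesAt-Rinv y)))
      sides≡padY : sides (f (π m)) ≡ pad Y
      sides≡padY = trans (sides-π m (≢cherry leaves≡′))
        (trans (cong₂ move (proj₁ split) (List.∷-injectiveʳ (List.∷-injectiveʳ (proj₂ split)))) (sym (proj₂ mv)))

    forget-mark : ∀ y → forget (mark y) ≡ y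
    forget-mark y = Rinv-≡ (proj₁ (proj₂ (markRinv y)))

    -- Both marks sit at the position of the unique •∘ pair of pad X that moves to give pad Y.
    mark-forget : ∀ x → mark (forget x) ≡ x
    mark-forget x@((m , _) , _) = 𝓕-≡ (mark-unique _ m (proj₁ (proj₂ (markRinv (forget x))))
      (trans (proj₂ (proj₂ (markRinv (forget x)))) (trans (sym (moveAt-unique (𝓕⇒moveAt x) mv)) (length-leftSides m))))

    𝓕↔Rinv-at : 𝓕 n C' C ↔ Rinv n C'
    𝓕↔Rinv-at = mk↔ₛ′ forget mark forget-mark mark-forget

  𝓕↔Rinv : Allowed X Y ≡ true → 𝓕 n C' C ↔ Rinv n C'
  𝓕↔Rinv allowed = 𝓕↔Rinv-at (proj₂ (proj₂ (allowed⇒moveAt X Y allowed)))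

  𝓕⇔W≢0 : ∀ {α β} → α ≢ 0ℚ → β ≢ 0ℚ → 𝓕 n C' C ⇔ (W α β C' C ≢ 0ℚ)
  𝓕⇔W≢0 {α} {β} α≢0 β≢0 = mk⇔
    (allowed⇒W≢0 C' C α≢0 β≢0 ∘ 𝓕⇒allowed)
    (λ W≢0 → Inverse.from (𝓕↔Rinv (W≢0⇒allowed α β C' C W≢0)) (Rinv-inhabited n C'))

  card-𝓕 : ∀ k m → (Rinv n C' ↔ Fin k) → (𝓕 n C' C ↔ Fin m) → (+ m / 1) ≡ (+ k / 1) * W 1ℚ 1ℚ C' C
  card-𝓕 k m Rinv↔k 𝓕↔m with Allowed X Y in allowed
  ... | true = begin
    + m / 1                ≡⟨ cong (λ i → + i / 1) m≡k ⟩
    + k / 1                ≡⟨ sym (ℚ.*-identityʳ (+ k / 1)) ⟩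
    + k / 1 * 1ℚ           ≡⟨ cong (+ k / 1 *_) (sym (W-1-1-allowed C' C allowed)) ⟩
    + k / 1 * W 1ℚ 1ℚ C' C ∎
    where
    open ≡-Reasoning
    m≡k : m ≡ k
    m≡k = ↔⇒≡ (↔-trans (↔-sym 𝓕↔m) (↔-trans (𝓕↔Rinv allowed) Rinv↔k))
  ... | false = begin
    + m / 1                ≡⟨ cong (λ i → + i / 1) m≡0 ⟩
    0ℚ                     ≡⟨ sym (ℚ.*-zeroʳ (+ k / 1)) ⟩
    + k / 1 * 0ℚ           ≡⟨ cong (+ k / 1 *_) (sym (W-disallowed 1ℚ 1ℚ C' C allowed)) ⟩
    + k / 1 * W 1ℚ 1ℚ C' C ∎
    where
    open ≡-Reasoning
    m≡0 : m ≡ 0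
    m≡0 = ↔Fin-empty (λ x → case trans (sym (𝓕⇒allowed x)) allowed of λ ()) 𝓕↔m

lemma3 : (n : ℕ) → 1 ≤ n → (C C' : Config n) →
    ((α β : ℚ) → 0ℚ < α → α ≤ℚ 1ℚ → 0ℚ < β → β ≤ℚ 1ℚ →
       (𝓕 n C' C ⇔ (W α β C' C ≢ 0ℚ))
       × (W α β C' C ≢ 0ℚ → 𝓕 n C' C ↔ Rinv n C'))
    × ((k m : ℕ) → (Rinv n C' ↔ Fin k) → (𝓕 n C' C ↔ Fin m) →
       (+ m / 1) ≡ (+ k / 1) * W 1ℚ 1ℚ C' C)
lemma3 n 1≤n C C' = rates , card-𝓕 1≤n C' C
  where
  >0⇒≢0 : ∀ {q} → 0ℚ < q → q ≢ 0ℚ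
  >0⇒≢0 0<q q≡0 = ℚ.<-irrefl (sym q≡0) 0<q
  rates : (α β : ℚ) → 0ℚ < α → α ≤ℚ 1ℚ → 0ℚ < β → β ≤ℚ 1ℚ →
          (𝓕 n C' C ⇔ (W α β C' C ≢ 0ℚ)) × (W α β C' C ≢ 0ℚ → 𝓕 n C' C ↔ Rinv n C')
  rates α β 0<α _ 0<β _ = 𝓕⇔W≢0 1≤n C' C (>0⇒≢0 0<α) (>0⇒≢0 0<β) , 𝓕↔Rinv 1≤n C' C ∘ W≢0⇒allowed α β C' C
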